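{- In a Cartesian closed differential category, a morphism $f:A\to B$ is linear if and only if for every object $C$ and every $g:C\to A$, $(f\circ\pi_2)\star g=f\circ g\circ\pi_1:C\times A\to B$ (where $\pi_2:C\times A\to A$).
   Context: Cartesian closed differential category: a category whose homsets are commutative monoids $(+,0)$ with $(g+h)\circ f=g\circ f+h\circ f$, $0\circ f=0$; with finite products in which projections are additive and pairings of additive maps are additive; with an operator $D$, $f:A\to B\mapsto D(f):A\times A\to B$, satisfying (D1) $D(f+g)=D(f)+D(g)$, $D(0)=0$; (D2) $D(f)\circ\langle h+k,v\rangle=D(f)\circ\langle h,v\rangle+D(f)\circ\langle k,v\rangle$, $D(f)\circ\langle0,v\rangle=0$; (D3) $D(\mathrm{Id})=\pi_1$, $D(\pi_1)=\pi_1\circ\pi_1$, $D(\pi_2)=\pi_2\circ\pi_1$; (D4) $D\langle f,g\rangle=\langle D(f),D(g)\rangle$; (D5) $D(f\circ g)=D(f)\circ\langle D(g),g\circ\pi_2\rangle$; (D6) $D(D(f))\circ\langle\langle g,0\rangle,\langle h,k\rangle\rangle=D(f)\circ\langle g,k\rangle$; (D7) $D(D(f))\circ\langle\langle0,h\rangle,\langle g,k\rangle\rangle=D(D(f))\circ\langle\langle0,g\rangle,\langle h,k\rangle\rangle$; Cartesian closed with $\Lambda(f+g)=\Lambda f+\Lambda g$, $\Lambda(0)=0$, $D(\Lambda f)=\Lambda(D(f)\circ\langle\pi_1\times0_A,\pi_2\times\mathrm{Id}_A\rangle)$. A morphism $f$ is linear if $D(f)=f\circ\pi_1$. For $f:C\times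 A\to B$ and $g:C\to A$, $f\star g=D(f)\circ\langle\langle0_C,g\circ\pi_1\rangle,\mathrm{Id}_{C\times A}\rangle:C\times A\to B$, with $0_C:C\times A\to C$ the zero morphism. -}

module Defs where

open import Level using (Level; _⊔_) renaming (suc to lsuc)
open import Relation.Binary using (Rel; IsEquivalence)
open import Algebra.Structures using (IsCommutativeMonoid)
open import Data.Product using (_×_)

record CCDC (o ℓ e : Level) : Set (lsuc (o ⊔ ℓ ⊔ e)) where
  infixr 9 _∘_
  infixl 6 _+_
  infix  4 _≈_
  infixr 7 _×₀_
  field
    Obj : Set o
    _⇒_ : Obj → Obj → Set ℓ
    _≈_ : ∀ {A B} → Rel (A ⇒ B) e
    ≈-isEquivalence : ∀ {A B} → IsEquivalence (_≈_ {A} {B})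
    id  : ∀ {A} → A ⇒ A
    _∘_ : ∀ {A B C} → B ⇒ C → A ⇒ B → A ⇒ C
    assoc : ∀ {A B C D} {f : A ⇒ B} {g : B ⇒ C} {h : C ⇒ D} →
            (h ∘ g) ∘ f ≈ h ∘ (g ∘ f)
    identityˡ : ∀ {A B} {f : A ⇒ B} → id ∘ f ≈ f
    identityʳ : ∀ {A B} {f : A ⇒ B} → f ∘ id ≈ f
    ∘-resp-≈ : ∀ {A B C} {f h : B ⇒ C} {g i : A ⇒ B} →
               f ≈ h → g ≈ i → f ∘ g ≈ h ∘ i

    _+_ : ∀ {A B} → A ⇒ B → A ⇒ B → A ⇒ B
    0h  : ∀ {A B} → A ⇒ B
    +-isCommutativeMonoid : ∀ {A B} → IsCommutativeMonoid (_≈_ {A} {B}) _+_ 0h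
    +-∘ : ∀ {A B C} (g h : B ⇒ C) (f : A ⇒ B) → (g + h) ∘ f ≈ g ∘ f + h ∘ f
    0-∘ : ∀ {A B C} (f : A ⇒ B) → (0h {B} {C}) ∘ f ≈ 0h

  Additive : ∀ {A B} → A ⇒ B → Set (o ⊔ ℓ ⊔ e)
  Additive {A} {B} f =
    (∀ {X} (g h : X ⇒ A) → f ∘ (g + h) ≈ f ∘ g + f ∘ h) × (∀ {X} → f ∘ 0h {X} {A} ≈ 0h)

  field
    ⊤ : Obj
    ! : ∀ {A} → A ⇒ ⊤
    !-unique : ∀ {A} (f : A ⇒ ⊤) → f ≈ !
    _×₀_ : Obj → Obj → Obj
    π₁ : ∀ {A B} → (A ×₀ B) ⇒ A
    π₂ : ∀ {A B} → (A ×₀ B) ⇒ B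
    ⟨_,_⟩ : ∀ {C A B} → C ⇒ A → C ⇒ B → C ⇒ (A ×₀ B)
    project₁ : ∀ {C A B} {f : C ⇒ A} {g : C ⇒ B} → π₁ ∘ ⟨ f , g ⟩ ≈ f
    project₂ : ∀ {C A B} {f : C ⇒ A} {g : C ⇒ B} → π₂ ∘ ⟨ f , g ⟩ ≈ g
    ⟨⟩-unique : ∀ {C A B} {f : C ⇒ A} {g : C ⇒ B} {h : C ⇒ (A ×₀ B)} →
                π₁ ∘ h ≈ f → π₂ ∘ h ≈ g → h ≈ ⟨ f , g ⟩
    π₁-additive : ∀ {A B} → Additive (π₁ {A} {B})
    π₂-additive : ∀ {A B} → Additive (π₂ {A} {B})
    ⟨⟩-additive : ∀ {C A B} {f : C ⇒ A} {g : C ⇒ B} →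
                  Additive f → Additive g → Additive ⟨ f , g ⟩

  _⁂_ : ∀ {A B C D} → A ⇒ B → C ⇒ D → (A ×₀ C) ⇒ (B ×₀ D)
  f ⁂ g = ⟨ f ∘ π₁ , g ∘ π₂ ⟩

  field
    D : ∀ {A B} → A ⇒ B → (A ×₀ A) ⇒ B
    D-resp-≈ : ∀ {A B} {f g : A ⇒ B} → f ≈ g → D f ≈ D g
    D1-+ : ∀ {A B} (f g : A ⇒ B) → D (f + g) ≈ D f + D g
    D1-0 : ∀ {A B} → D (0h {A} {B}) ≈ 0h
    D2-+ : ∀ {A B C} (f : A ⇒ B) (h k v : C ⇒ A) →
           D f ∘ ⟨ h + k , v ⟩ ≈ D f ∘ ⟨ h , v ⟩ + D f ∘ ⟨ k , v ⟩
    D2-0 : ∀ {A B C} (f : A ⇒ B) (v : C ⇒ A) → D f ∘ ⟨ 0h , v ⟩ ≈ 0h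
    D3-id : ∀ {A} → D (id {A}) ≈ π₁
    D3-π₁ : ∀ {A B} → D (π₁ {A} {B}) ≈ π₁ ∘ π₁
    D3-π₂ : ∀ {A B} → D (π₂ {A} {B}) ≈ π₂ ∘ π₁
    D4 : ∀ {C A B} (f : C ⇒ A) (g : C ⇒ B) → D ⟨ f , g ⟩ ≈ ⟨ D f , D g ⟩
    D5 : ∀ {A B C} (f : B ⇒ C) (g : A ⇒ B) → D (f ∘ g) ≈ D f ∘ ⟨ D g , g ∘ π₂ ⟩
    D6 : ∀ {A B C} (f : A ⇒ B) (g h k : C ⇒ A) →
         D (D f) ∘ ⟨ ⟨ g , 0h ⟩ , ⟨ h , k ⟩ ⟩ ≈ D f ∘ ⟨ g , k ⟩
    D7 : ∀ {A B C} (f : A ⇒ B) (g h k : C ⇒ A) →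
         D (D f) ∘ ⟨ ⟨ 0h , h ⟩ , ⟨ g , k ⟩ ⟩ ≈ D (D f) ∘ ⟨ ⟨ 0h , g ⟩ , ⟨ h , k ⟩ ⟩

    _⇨_ : Obj → Obj → Obj
    ev : ∀ {A B} → ((A ⇨ B) ×₀ A) ⇒ B
    Λ : ∀ {C A B} → (C ×₀ A) ⇒ B → C ⇒ (A ⇨ B)
    β : ∀ {C A B} (f : (C ×₀ A) ⇒ B) → ev ∘ (Λ f ⁂ id) ≈ f
    Λ-unique : ∀ {C A B} {f : (C ×₀ A) ⇒ B} {h : C ⇒ (A ⇨ B)} →
               ev ∘ (h ⁂ id) ≈ f → h ≈ Λ f
    Λ-+ : ∀ {C A B} (f g : (C ×₀ A) ⇒ B) → Λ (f + g) ≈ Λ f + Λ g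
    Λ-0 : ∀ {C A B} → Λ (0h {C ×₀ A} {B}) ≈ 0h
    D-Λ : ∀ {C A B} (f : (C ×₀ A) ⇒ B) →
          D (Λ f) ≈ Λ (D f ∘ ⟨ π₁ ⁂ 0h {A} {A} , π₂ ⁂ id {A} ⟩)

  Linear : ∀ {A B} → A ⇒ B → Set e
  Linear f = D f ≈ f ∘ π₁

  _⋆_ : ∀ {C A B} → (C ×₀ A) ⇒ B → C ⇒ A → (C ×₀ A) ⇒ B
  f ⋆ g = D f ∘ ⟨ ⟨ 0h , g ∘ π₁ ⟩ , id ⟩

module Submission where

open import Defs
open import Data.Product using (_×_; _,_)
open import Level using (Level)
open import Relation.Binary using (Setoid; IsEquivalence)
import Relation.Binary.Reasoning.Setoid as SetoidReasoning

-- Both directions rest on one computation: since π₂ is linear, the chain rule gives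
-- (f ∘ π₂) ⋆ g ≈ D f ∘ ⟨ g ∘ π₁ , π₂ ⟩, i.e. D f evaluated at direction g and point π₂.
-- Linearity of f collapses this to f ∘ g ∘ π₁; conversely, taking C = A and g = id
-- turns ⟨ g ∘ π₁ , π₂ ⟩ into the identity, leaving D f ≈ f ∘ π₁.
module _ {o ℓ e : Level} (𝒞 : CCDC o ℓ e) where
  open CCDC 𝒞

  hom : Obj → Obj → Setoid ℓ e
  hom A B = record { Carrier = A ⇒ B ; _≈_ = _≈_ ; isEquivalence = ≈-isEquivalence }

  private
    module _ {A B : Obj} where
      open IsEquivalence (≈-isEquivalence {A} {B}) public
        renaming (refl to ≈-refl; sym to ≈-sym; trans to ≈-trans)

  ⟨⟩∘ : ∀ {X C A B} {a : C ⇒ A} {b : C ⇒ B} {h : X ⇒ C} →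
        ⟨ a , b ⟩ ∘ h ≈ ⟨ a ∘ h , b ∘ h ⟩
  ⟨⟩∘ = ⟨⟩-unique (≈-trans (≈-sym assoc) (∘-resp-≈ project₁ ≈-refl))
                  (≈-trans (≈-sym assoc) (∘-resp-≈ project₂ ≈-refl))

  ⁂∘⟨⟩ : ∀ {X A B C D} {f : A ⇒ B} {g : C ⇒ D} {a : X ⇒ A} {c : X ⇒ C} →
         (f ⁂ g) ∘ ⟨ a , c ⟩ ≈ ⟨ f ∘ a , g ∘ c ⟩
  ⁂∘⟨⟩ = ≈-trans ⟨⟩∘ (⟨⟩-unique
    (≈-trans project₁ (≈-trans assoc (∘-resp-≈ ≈-refl project₁)))
    (≈-trans project₂ (≈-trans assoc (∘-resp-≈ ≈-refl project₂))))

  ⟨π₁,π₂⟩≈id : ∀ {A B} → ⟨ π₁ {A} {B} , π₂ ⟩ ≈ id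
  ⟨π₁,π₂⟩≈id = ≈-sym (⟨⟩-unique identityʳ identityʳ)

  D-∘π₂ : ∀ {C A B} (f : A ⇒ B) → D (f ∘ π₂ {C} {A}) ≈ D f ∘ (π₂ ⁂ π₂)
  D-∘π₂ f = ≈-trans (D5 f π₂)
    (∘-resp-≈ ≈-refl (⟨⟩-unique (≈-trans project₁ D3-π₂) project₂))

  ⋆-∘π₂ : ∀ {C A B} (f : A ⇒ B) (g : C ⇒ A) →
          (f ∘ π₂ {C} {A}) ⋆ g ≈ D f ∘ ⟨ g ∘ π₁ , π₂ ⟩
  ⋆-∘π₂ {C} {A} {B} f g = begin
      D (f ∘ π₂) ∘ ⟨ ⟨ 0h , g ∘ π₁ ⟩ , id ⟩
    ≈⟨ ∘-resp-≈ (D-∘π₂ f) ≈-refl ⟩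
      (D f ∘ (π₂ ⁂ π₂)) ∘ ⟨ ⟨ 0h , g ∘ π₁ ⟩ , id ⟩
    ≈⟨ assoc ⟩
      D f ∘ ((π₂ ⁂ π₂) ∘ ⟨ ⟨ 0h , g ∘ π₁ ⟩ , id ⟩)
    ≈⟨ ∘-resp-≈ ≈-refl (≈-trans ⁂∘⟨⟩ (⟨⟩-unique (≈-trans project₁ project₂)
                                                 (≈-trans project₂ identityʳ))) ⟩
      D f ∘ ⟨ g ∘ π₁ , π₂ ⟩
    ∎
    where open SetoidReasoning (hom (C ×₀ A) B)

  Linear⇒D∘⟨⟩ : ∀ {X A B} {f : A ⇒ B} → Linear f →
                (h k : X ⇒ A) → D f ∘ ⟨ h , k ⟩ ≈ f ∘ h
  Linear⇒D∘⟨⟩ lin h k =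
    ≈-trans (∘-resp-≈ lin ≈-refl) (≈-trans assoc (∘-resp-≈ ≈-refl project₁))

  Linear⇒⋆-∘π₂ : ∀ {A B} {f : A ⇒ B} → Linear f → ∀ (C : Obj) (g : C ⇒ A) →
                 (f ∘ π₂ {C} {A}) ⋆ g ≈ f ∘ g ∘ π₁ {C} {A}
  Linear⇒⋆-∘π₂ {f = f} lin C g =
    ≈-trans (⋆-∘π₂ f g) (Linear⇒D∘⟨⟩ lin (g ∘ π₁) π₂)

  ⋆-∘π₂-id⇒Linear : ∀ {A B} {f : A ⇒ B} →
                    (f ∘ π₂ {A} {A}) ⋆ id ≈ f ∘ id ∘ π₁ → Linear f
  ⋆-∘π₂-id⇒Linear {A} {B} {f} H = begin
      D f
    ≈⟨ ≈-sym (≈-trans (∘-resp-≈ ≈-refl at-id) identityʳ) ⟩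
      D f ∘ ⟨ id ∘ π₁ , π₂ ⟩
    ≈⟨ ≈-sym (⋆-∘π₂ f id) ⟩
      (f ∘ π₂) ⋆ id
    ≈⟨ H ⟩
      f ∘ id ∘ π₁
    ≈⟨ ∘-resp-≈ ≈-refl identityˡ ⟩
      f ∘ π₁
    ∎
    where
      open SetoidReasoning (hom (A ×₀ A) B)
      at-id : ⟨ id ∘ π₁ , π₂ ⟩ ≈ id {A ×₀ A}
      at-id = ≈-trans (⟨⟩-unique (≈-trans project₁ identityˡ) project₂) ⟨π₁,π₂⟩≈id

lemma3p13 : ∀ {o ℓ e} (𝒞 : CCDC o ℓ e) → let open CCDC 𝒞 in
    ∀ {A B} (f : A ⇒ B) →
      (Linear f → ∀ (C : Obj) (g : C ⇒ A) → (f ∘ π₂ {C} {A}) ⋆ g ≈ f ∘ g ∘ π₁ {C} {A})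
      × ((∀ (C : Obj) (g : C ⇒ A) → (f ∘ π₂ {C} {A}) ⋆ g ≈ f ∘ g ∘ π₁ {C} {A}) → Linear f)
lemma3p13 𝒞 {A} f =
  Linear⇒⋆-∘π₂ 𝒞 , λ H → ⋆-∘π₂-id⇒Linear 𝒞 (H A (CCDC.id 𝒞))
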